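{- Let $(G,T)$ be a generated group with $T$ closed under conjugation by elements of $G$, and let $\le$ be its prefix order. Then for any $x\le z$ in $G$, the bijection $G\to G$, $y\mapsto xy^{ -1}z$, restricts to a poset anti-automorphism of the interval $[x,z]=\{y\in G: x\le y\le z\}$.
   Context: A generated group is a pair $(G,T)$ with $G$ a group and $T\subseteq G$ generating $G$ as a monoid. The length $\ell(g)=\ell_T(g)$ is the minimum $\ell$ such that $g=t_1\cdots t_\ell$ with $t_i\in T$ ($\ell(e)=0$). The prefix order is defined by $g\le h$ iff $\ell(g)+\ell(g^{ -1}h)=\ell(h)$. -}

module Defs where

open import Level using (Level; _⊔_)
open import Algebra.Bundles using (Group)
open import Data.Nat using (ℕ; _≤_; _+_)
open import Data.List using (List; foldr; length)
open import Data.List.Relation.Unary.All using (All)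
open import Data.Product using (Σ; ∃; ∃-syntax; _×_)
open import Relation.Binary.PropositionalEquality using (_≡_)
open import Function.Bundles using (_⇔_)

module _ {c ℓ : Level} (G : Group c ℓ) where
  open Group G

  prod : List Carrier → Carrier
  prod = foldr _∙_ ε

  module _ {t : Level} (T : Carrier → Set t) where

    -- T is a subset of G (predicate respecting the group equality)
    IsSubset : Set (c ⊔ ℓ ⊔ t)
    IsSubset = ∀ {a b} → a ≈ b → T a → T b

    GeneratesAsMonoid : Set (c ⊔ ℓ ⊔ t)
    GeneratesAsMonoid = ∀ g → ∃[ ws ] (All T ws × prod ws ≈ g)

    ConjugationClosed : Set (c ⊔ t)
    ConjugationClosed = ∀ g s → T s → T (g ∙ s ∙ g ⁻¹)

    WordOfLength : Carrier → ℕ → Set (c ⊔ ℓ ⊔ t)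
    WordOfLength g n = ∃[ ws ] (length ws ≡ n × All T ws × prod ws ≈ g)

    HasLength : Carrier → ℕ → Set (c ⊔ ℓ ⊔ t)
    HasLength g n = WordOfLength g n × (∀ m → WordOfLength g m → n ≤ m)

    PrefixLe : Carrier → Carrier → Set (c ⊔ ℓ ⊔ t)
    PrefixLe g h = ∃[ a ] ∃[ b ] ∃[ k ]
      (HasLength g a × HasLength (g ⁻¹ ∙ h) b × HasLength h k × a + b ≡ k)

    InInterval : Carrier → Carrier → Carrier → Set (c ⊔ ℓ ⊔ t)
    InInterval x z y = PrefixLe x y × PrefixLe y z

    IsIntervalAntiAutomorphism : Carrier → Carrier → (Carrier → Carrier) → Set (c ⊔ ℓ ⊔ t)
    IsIntervalAntiAutomorphism x z f =
      (∀ y → InInterval x z y → InInterval x z (f y)) ×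
      (∀ y₁ y₂ → InInterval x z y₁ → InInterval x z y₂ → f y₁ ≈ f y₂ → y₁ ≈ y₂) ×
      (∀ w → InInterval x z w → ∃[ y ] (InInterval x z y × f y ≈ w)) ×
      (∀ y₁ y₂ → InInterval x z y₁ → InInterval x z y₂ →
        (PrefixLe y₁ y₂ ⇔ PrefixLe (f y₂) (f y₁)))

-- Because T is closed under conjugation, ℓ is constant on conjugacy classes, so the
-- (possibly asymmetric) distance d(g,h) = ℓ(g⁻¹h) is invariant under left and right
-- translations, and f y = xy⁻¹z satisfies d(f y₁, f y₂) = d(y₂, y₁).  As f x = z and
-- f z = x, this gives d(x, f y) = d(y, z) and d(f y, z) = d(x, y): f maps the interval
-- {y : d(x,y) + d(y,z) = d(x,z)} to itself, swapping the two summands.  Inside the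
-- interval, y₁ ≤ y₂ says d(x,y₁) + d(y₁,y₂) = d(x,y₂), which after this swap and the
-- identity d(f y₂, f y₁) = d(y₁, y₂) is exactly f y₂ ≤ f y₁.
module Submission where

open import Defs
open import Level using (Level; _⊔_)
open import Algebra.Bundles using (Group)
open import Data.Nat using (ℕ; _+_)
open import Data.Nat.Properties using (≤-antisym; +-cancelʳ-≡; +-cancelʳ-≤; +-commutativeSemigroup)
open import Algebra.Properties.CommutativeSemigroup +-commutativeSemigroup using (xy∙z≈xz∙y)
open import Data.List using ([]; _∷_; _++_; map)
open import Data.List.Properties using (length-++; length-map)
open import Data.List.Relation.Unary.All.Properties using (++⁺; gmap⁺)
open import Data.Product using (∃-syntax; _×_; _,_; proj₁)
open import Relation.Binary.PropositionalEquality as ≡ using (_≡_)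
open import Function.Bundles using (_⇔_; mk⇔; Equivalence)
import Algebra.Properties.Group as GroupProperties
import Relation.Binary.Reasoning.Setoid as SetoidReasoning

exchange : ∀ a b₁ c₁ b₂ c₂ d → a + b₁ + c₁ ≡ a + b₂ + c₂ →
           a + b₁ + d ≡ a + b₂ → a + c₂ + d ≡ a + c₁
exchange a b₁ c₁ b₂ c₂ d e b₁+d≡b₂ = +-cancelʳ-≡ b₁ _ _ (begin
  a + c₂ + d + b₁  ≡⟨ xy∙z≈xz∙y (a + c₂) d b₁ ⟩
  a + c₂ + b₁ + d  ≡⟨ ≡.cong (_+ d) (xy∙z≈xz∙y a c₂ b₁) ⟩
  a + b₁ + c₂ + d  ≡⟨ xy∙z≈xz∙y (a + b₁) c₂ d ⟩
  a + b₁ + d + c₂  ≡⟨ ≡.cong (_+ c₂) b₁+d≡b₂ ⟩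
  a + b₂ + c₂      ≡⟨ e ⟨
  a + b₁ + c₁      ≡⟨ xy∙z≈xz∙y a b₁ c₁ ⟩
  a + c₁ + b₁      ∎)
  where open ≡.≡-Reasoning

exchange⇔ : ∀ a b₁ c₁ b₂ c₂ d → a + b₁ + c₁ ≡ a + b₂ + c₂ →
            a + b₁ + d ≡ a + b₂ ⇔ a + c₂ + d ≡ a + c₁
exchange⇔ a b₁ c₁ b₂ c₂ d e = mk⇔ (exchange a b₁ c₁ b₂ c₂ d e) (exchange a c₂ b₂ c₁ b₁ d e′)
  where
  e′ : a + c₂ + b₂ ≡ a + c₁ + b₁
  e′ = ≡.trans (xy∙z≈xz∙y a c₂ b₂) (≡.trans (≡.sym e) (xy∙z≈xz∙y a b₁ c₁))

module PrefixOrder {c ℓ t : Level} (G : Group c ℓ) (T : Group.Carrier G → Set t) where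
  open Group G
  open GroupProperties G
  open SetoidReasoning setoid

  //-∙-cancel : ∀ a b d → (a // b) ∙ (b ∙ d) ≈ a ∙ d
  //-∙-cancel a b d = trans (assoc a (b ⁻¹) (b ∙ d)) (∙-congˡ (\\-leftDividesʳ b d))

  \\-cocycle : ∀ a b d → (a \\ b) ∙ (b \\ d) ≈ a \\ d
  \\-cocycle a b d = trans (assoc (a ⁻¹) b (b \\ d)) (∙-congˡ (\\-leftDividesˡ b d))

  conjugate : Carrier → Carrier → Carrier
  conjugate u g = u ∙ g ∙ u ⁻¹

  conjugate-ε : ∀ u → conjugate u ε ≈ ε
  conjugate-ε u = trans (∙-congʳ (identityʳ u)) (inverseʳ u)

  conjugate-∙ : ∀ u g h → conjugate u g ∙ conjugate u h ≈ conjugate u (g ∙ h)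
  conjugate-∙ u g h = begin
    ((u ∙ g) // u) ∙ ((u ∙ h) // u)  ≈⟨ assoc _ _ _ ⟨
    ((u ∙ g) // u) ∙ (u ∙ h) // u    ≈⟨ ∙-congʳ (//-∙-cancel (u ∙ g) u h) ⟩
    (u ∙ g ∙ h) // u                 ≈⟨ ∙-congʳ (assoc u g h) ⟩
    (u ∙ (g ∙ h)) // u               ∎

  conjugate-inverse : ∀ u g → conjugate (u ⁻¹) (conjugate u g) ≈ g
  conjugate-inverse u g = begin
    u ⁻¹ ∙ ((u ∙ g) // u) ∙ u ⁻¹ ⁻¹  ≈⟨ ∙-congˡ (⁻¹-involutive u) ⟩
    u ⁻¹ ∙ ((u ∙ g) // u) ∙ u        ≈⟨ assoc _ _ _ ⟩
    u ⁻¹ ∙ (((u ∙ g) // u) ∙ u)      ≈⟨ ∙-congˡ (//-rightDividesˡ u (u ∙ g)) ⟩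
    u \\ (u ∙ g)                     ≈⟨ \\-leftDividesʳ u g ⟩
    g                                ∎

  conjugate-\\ : ∀ a b d → conjugate (a \\ b) (b \\ d) ≈ (a \\ d) ∙ (b \\ a)
  conjugate-\\ a b d = ∙-cong (\\-cocycle a b d) (⁻¹-anti-homo-\\ a b)

  prod-++ : ∀ us vs → prod G (us ++ vs) ≈ prod G us ∙ prod G vs
  prod-++ []       vs = sym (identityˡ _)
  prod-++ (u ∷ us) vs = trans (∙-congˡ (prod-++ us vs)) (sym (assoc _ _ _))

  prod-map-conjugate : ∀ u ws → prod G (map (conjugate u) ws) ≈ conjugate u (prod G ws)
  prod-map-conjugate u []       = sym (conjugate-ε u)
  prod-map-conjugate u (w ∷ ws) =
    trans (∙-congˡ (prod-map-conjugate u ws)) (conjugate-∙ u w (prod G ws))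

  Word Length : Carrier → ℕ → Set (c ⊔ ℓ ⊔ t)
  Word   = WordOfLength G T
  Length = HasLength G T

  word-resp : ∀ {g h n} → g ≈ h → Word g n → Word h n
  word-resp g≈h (ws , len , ws∈T , prod≈g) = ws , len , ws∈T , trans prod≈g g≈h

  word-∙ : ∀ {g h m n} → Word g m → Word h n → Word (g ∙ h) (m + n)
  word-∙ (us , ≡.refl , us∈T , prod≈g) (vs , ≡.refl , vs∈T , prod≈h) =
    us ++ vs , length-++ us , ++⁺ us∈T vs∈T , trans (prod-++ us vs) (∙-cong prod≈g prod≈h)

  length-resp : ∀ {g h n} → g ≈ h → Length g n → Length h n
  length-resp g≈h (w , minimal) =
    word-resp g≈h w , λ m w′ → minimal m (word-resp (sym g≈h) w′)

  length-unique : ∀ {g m n} → Length g m → Length g n → m ≡ n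
  length-unique (wm , minimalm) (wn , minimaln) = ≤-antisym (minimalm _ wn) (minimaln _ wm)

  length-leftFactor : ∀ {g h k m n} → Word g m → Word h n → g ∙ h ≈ k →
                      Length k (m + n) → Length g m
  length-leftFactor {m = m} {n} wg wh gh≈k (_ , minimal) =
    wg , λ m′ wg′ → +-cancelʳ-≤ n m m′ (minimal _ (word-resp gh≈k (word-∙ wg′ wh)))

  module Conjugation (closed : ConjugationClosed G T) where

    word-conjugate : ∀ u {g n} → Word g n → Word (conjugate u g) n
    word-conjugate u (ws , ≡.refl , ws∈T , prod≈g) =
      map (conjugate u) ws , length-map (conjugate u) ws , gmap⁺ (closed u _) ws∈T ,
      trans (prod-map-conjugate u ws) (∙-congʳ (∙-congˡ prod≈g))

    word-unconjugate : ∀ u {g n} → Word (conjugate u g) n → Word g n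
    word-unconjugate u {g} w = word-resp (conjugate-inverse u g) (word-conjugate (u ⁻¹) w)

    length-conjugate⇔ : ∀ u {g h n} → h ≈ conjugate u g → Length g n ⇔ Length h n
    length-conjugate⇔ u h≈ugu⁻¹ = mk⇔
      (λ (w , minimal) → length-resp (sym h≈ugu⁻¹)
        (word-conjugate u w , λ m w′ → minimal m (word-unconjugate u w′)))
      (λ ℓh → let (w , minimal) = length-resp h≈ugu⁻¹ ℓh in
        word-unconjugate u w , λ m w′ → minimal m (word-conjugate u w′))

  prefixLe⇐ : ∀ {g h m d n} → Length g m → Length (g \\ h) d → Length h n → m + d ≡ n →
              PrefixLe G T g h
  prefixLe⇐ ℓg ℓd ℓh e = _ , _ , _ , ℓg , ℓd , ℓh , e

  prefixLe⇒ : ∀ {g h m} → Length g m → PrefixLe G T g h →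
              ∃[ d ] (Length (g \\ h) d × Length h (m + d))
  prefixLe⇒ {h = h} ℓg (_ , d , _ , ℓg′ , ℓd , ℓh , e) =
    d , ℓd , ≡.subst (Length h) (≡.trans (≡.sym e) (≡.cong (_+ d) (length-unique ℓg′ ℓg))) ℓh

  prefixLe⇔ : ∀ {g h m n} → Length g m → Length h n →
              PrefixLe G T g h ⇔ (∃[ d ] (Length (g \\ h) d × m + d ≡ n))
  prefixLe⇔ ℓg ℓh = mk⇔
    (λ g≤h → let (d , ℓd , ℓh′) = prefixLe⇒ ℓg g≤h in d , ℓd , length-unique ℓh′ ℓh)
    (λ (d , ℓd , e) → prefixLe⇐ ℓg ℓd ℓh e)

  module Reflection (closed : ConjugationClosed G T) {x z : Carrier} {a L : ℕ}
                    (ℓx : Length x a) (ℓz : Length z L) where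
    open Conjugation closed

    reflect : Carrier → Carrier
    reflect y = (x // y) ∙ z

    \\-reflect : ∀ y → x \\ reflect y ≈ y \\ z
    \\-reflect y = trans (∙-congˡ (assoc x (y ⁻¹) z)) (\\-leftDividesʳ x (y \\ z))

    reflect-\\-reflect : ∀ y₁ y₂ → reflect y₂ \\ reflect y₁ ≈ conjugate (z \\ y₁) (y₁ \\ y₂)
    reflect-\\-reflect y₁ y₂ = begin
      ((x // y₂) ∙ z) ⁻¹ ∙ ((x // y₁) ∙ z)      ≈⟨ ∙-congʳ (⁻¹-anti-homo-∙ (x // y₂) z) ⟩
      z ⁻¹ ∙ (x // y₂) ⁻¹ ∙ ((x // y₁) ∙ z)     ≈⟨ ∙-congʳ (∙-congˡ (⁻¹-anti-homo-// x y₂)) ⟩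
      z ⁻¹ ∙ (y₂ // x) ∙ ((x // y₁) ∙ z)        ≈⟨ assoc _ _ _ ⟩
      z ⁻¹ ∙ ((y₂ // x) ∙ ((x // y₁) ∙ z))      ≈⟨ ∙-congˡ (∙-congˡ (assoc x (y₁ ⁻¹) z)) ⟩
      z ⁻¹ ∙ ((y₂ // x) ∙ (x ∙ (y₁ \\ z)))      ≈⟨ ∙-congˡ (//-∙-cancel y₂ x (y₁ \\ z)) ⟩
      z ⁻¹ ∙ (y₂ ∙ (y₁ \\ z))                   ≈⟨ assoc _ _ _ ⟨
      (z \\ y₂) ∙ (y₁ \\ z)                     ≈⟨ conjugate-\\ z y₁ y₂ ⟨
      conjugate (z \\ y₁) (y₁ \\ y₂)            ∎

    reflect-x : reflect x ≈ z
    reflect-x = trans (∙-congʳ (inverseʳ x)) (identityˡ z)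

    reflect-\\-z : ∀ y → reflect y \\ z ≈ conjugate (z \\ x) (x \\ y)
    reflect-\\-z y = trans (\\-cong₂ refl (sym reflect-x)) (reflect-\\-reflect x y)

    reflect-injective : ∀ {y₁ y₂} → reflect y₁ ≈ reflect y₂ → y₁ ≈ y₂
    reflect-injective {y₁} {y₂} e = ⁻¹-injective (begin
      y₁ ⁻¹                    ≈⟨ //-rightDividesʳ z (y₁ ⁻¹) ⟨
      (y₁ \\ z) // z           ≈⟨ ∙-congʳ (\\-reflect y₁) ⟨
      (x \\ reflect y₁) // z   ≈⟨ ∙-congʳ (∙-congˡ e) ⟩
      (x \\ reflect y₂) // z   ≈⟨ ∙-congʳ (\\-reflect y₂) ⟩
      (y₂ \\ z) // z           ≈⟨ //-rightDividesʳ z (y₂ ⁻¹) ⟩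
      y₂ ⁻¹                    ∎)

    reflect-surjective : ∀ w → reflect ((z // w) ∙ x) ≈ w
    reflect-surjective w = begin
      (x // ((z // w) ∙ x)) ∙ z     ≈⟨ ∙-congʳ (∙-congˡ (⁻¹-anti-homo-∙ (z // w) x)) ⟩
      x ∙ (x ⁻¹ ∙ (z // w) ⁻¹) ∙ z  ≈⟨ ∙-congʳ (∙-congˡ (∙-congˡ (⁻¹-anti-homo-// z w))) ⟩
      x ∙ (x \\ (w // z)) ∙ z       ≈⟨ ∙-congʳ (\\-leftDividesˡ x (w // z)) ⟩
      (w // z) ∙ z                  ≈⟨ //-rightDividesˡ z w ⟩
      w                             ∎

    Splits : Carrier → ℕ → ℕ → Set (c ⊔ ℓ ⊔ t)
    Splits y b c = Length (x \\ y) b × Length (y \\ z) c × a + b + c ≡ L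

    splits-resp : ∀ {y y′ b c} → y ≈ y′ → Splits y b c → Splits y′ b c
    splits-resp y≈y′ (ℓxy , ℓyz , e) =
      length-resp (\\-cong₂ refl y≈y′) ℓxy , length-resp (\\-cong₂ y≈y′ refl) ℓyz , e

    splits⇒length : ∀ {y b c} → Splits y b c → Length y (a + b)
    splits⇒length {y} (ℓxy , ℓyz , e) =
      length-leftFactor (word-resp (\\-leftDividesˡ x y) (word-∙ (proj₁ ℓx) (proj₁ ℓxy)))
                        (proj₁ ℓyz) (\\-leftDividesˡ y z) (≡.subst (Length z) (≡.sym e) ℓz)

    splits⇒inInterval : ∀ {y b c} → Splits y b c → InInterval G T x z y
    splits⇒inInterval s@(ℓxy , ℓyz , e) =
      prefixLe⇐ ℓx ℓxy (splits⇒length s) ≡.refl , prefixLe⇐ (splits⇒length s) ℓyz ℓz e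

    inInterval⇒splits : ∀ {y} → InInterval G T x z y → ∃[ b ] ∃[ c ] Splits y b c
    inInterval⇒splits (x≤y , y≤z) =
      let (b , ℓxy , ℓy) = prefixLe⇒ ℓx x≤y
          (c , ℓyz , ℓz′) = prefixLe⇒ ℓy y≤z
      in b , c , ℓxy , ℓyz , length-unique ℓz′ ℓz

    reflect-splits⇔ : ∀ {y b c} → Splits y b c ⇔ Splits (reflect y) c b
    reflect-splits⇔ {y} {b} {c} = mk⇔
      (λ (ℓxy , ℓyz , e) → length-resp (sym (\\-reflect y)) ℓyz ,
                           Equivalence.to conjugate⇔ ℓxy , ≡.trans (xy∙z≈xz∙y a c b) e)
      (λ (ℓxr , ℓrz , e) → Equivalence.from conjugate⇔ ℓrz ,
                           length-resp (\\-reflect y) ℓxr , ≡.trans (xy∙z≈xz∙y a b c) e)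
      where
      conjugate⇔ : Length (x \\ y) b ⇔ Length (reflect y \\ z) b
      conjugate⇔ = length-conjugate⇔ (z \\ x) (reflect-\\-z y)

    reflect-antitone⇔ : ∀ {y₁ y₂ b₁ c₁ b₂ c₂} → Splits y₁ b₁ c₁ → Splits y₂ b₂ c₂ →
                        PrefixLe G T y₁ y₂ ⇔ PrefixLe G T (reflect y₂) (reflect y₁)
    reflect-antitone⇔ {y₁} {y₂} {b₁} {c₁} {b₂} {c₂} s₁@(_ , _ , e₁) s₂@(_ , _ , e₂) = mk⇔
      (λ y₁≤y₂ → let (d , ℓd , e) = to before y₁≤y₂ in
        from after (d , to quotient⇔ ℓd , to lengths⇔ e))
      (λ r₂≤r₁ → let (d , ℓd , e) = to after r₂≤r₁ in
        from before (d , from quotient⇔ ℓd , from lengths⇔ e))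
      where
      open Equivalence

      before : PrefixLe G T y₁ y₂ ⇔ (∃[ d ] (Length (y₁ \\ y₂) d × a + b₁ + d ≡ a + b₂))
      before = prefixLe⇔ (splits⇒length s₁) (splits⇒length s₂)

      after : PrefixLe G T (reflect y₂) (reflect y₁) ⇔
              (∃[ d ] (Length (reflect y₂ \\ reflect y₁) d × a + c₂ + d ≡ a + c₁))
      after = prefixLe⇔ (splits⇒length (to reflect-splits⇔ s₂))
                        (splits⇒length (to reflect-splits⇔ s₁))

      quotient⇔ : ∀ {d} → Length (y₁ \\ y₂) d ⇔ Length (reflect y₂ \\ reflect y₁) d
      quotient⇔ = length-conjugate⇔ (z \\ y₁) (reflect-\\-reflect y₁ y₂)

      lengths⇔ : ∀ {d} → a + b₁ + d ≡ a + b₂ ⇔ a + c₂ + d ≡ a + c₁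
      lengths⇔ {d} = exchange⇔ a b₁ c₁ b₂ c₂ d (≡.trans e₁ (≡.sym e₂))

    reflect-inInterval : ∀ y → InInterval G T x z y → InInterval G T x z (reflect y)
    reflect-inInterval y y∈ =
      let (_ , _ , s) = inInterval⇒splits y∈
      in splits⇒inInterval (Equivalence.to reflect-splits⇔ s)

    reflect-ontoInterval : ∀ w → InInterval G T x z w →
                           ∃[ y ] (InInterval G T x z y × reflect y ≈ w)
    reflect-ontoInterval w w∈ =
      let (_ , _ , s) = inInterval⇒splits w∈ in
      (z // w) ∙ x ,
      splits⇒inInterval
        (Equivalence.from reflect-splits⇔ (splits-resp (sym (reflect-surjective w)) s)) ,
      reflect-surjective w

    reflect-antitoneOnInterval : ∀ y₁ y₂ → InInterval G T x z y₁ → InInterval G T x z y₂ →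
                                 PrefixLe G T y₁ y₂ ⇔ PrefixLe G T (reflect y₂) (reflect y₁)
    reflect-antitoneOnInterval _ _ y₁∈ y₂∈ =
      let (_ , _ , s₁) = inInterval⇒splits y₁∈
          (_ , _ , s₂) = inInterval⇒splits y₂∈
      in reflect-antitone⇔ s₁ s₂

-- T need be neither ≈-closed nor generating: every length used is witnessed by a hypothesis.
proposition2p5 : {c ℓ t : Level} (G : Group c ℓ) (T : Group.Carrier G → Set t) →
    IsSubset G T → GeneratesAsMonoid G T → ConjugationClosed G T →
    ∀ x z → PrefixLe G T x z →
    IsIntervalAntiAutomorphism G T x z
      (λ y → Group._∙_ G (Group._∙_ G x (Group._⁻¹ G y)) z)
proposition2p5 G T _ _ closed x z (_ , _ , _ , ℓx , _ , ℓz , _) =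
  reflect-inInterval ,
  (λ _ _ _ _ → reflect-injective) ,
  reflect-ontoInterval ,
  reflect-antitoneOnInterval
  where open PrefixOrder.Reflection G T closed ℓx ℓz
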